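{- Let $\mathcal{K}=(\mathcal{O},\mathcal{P})$ be a DL-safe hybrid knowledge base with function symbols. Then the operator $\Phi_{\mathcal{K}}$ is monotonic with respect to $\le$: if $\mathcal{I}\le\mathcal{I}'$ are 3-valued interpretations for $\mathcal{K}$, then $\Phi_{\mathcal{K}}(\mathcal{I})\le\Phi_{\mathcal{K}}(\mathcal{I}')$.
   Context: A hybrid knowledge base with function symbols is a pair $\mathcal{K}=(\mathcal{O},\mathcal{P})$ where $\mathcal{O}$ is a finite set of description logic axioms translated to a first-order theory $\pi(\mathcal{O})$ by the standard translation, and $\mathcal{P}$ is a finite set of normal rules $h\leftarrow a_1,\dots,a_n,\mathit{not}\,b_1,\dots,\mathit{not}\,b_m$ whose atoms may contain function symbols. An atom is a DL-atom if its predicate occurs in $\mathcal{O}$; $\mathcal{K}$ is DL-safe if in every rule each variable occurs in some positive non-DL-atom of the body. $\mathcal{P}_g$ is the grounding of $\mathcal{P}$ (all ground instances over terms built from the constants and function symbols of $\mathcal{K}$); $\mathrm{KA}(\mathcal{K})$ is the set of ground atoms occurring in $\mathcal{P}_g$. For $S\subseteq\mathrm{KA}(\mathcal{K})$, $\mathrm{OB}_{\mathcal{K}}(S)=\{\pi(\mathcal{O})\}\cup S$; $\models$ is first-order entailment. A 3-valued interpretation is a pair $(I_T,I_F)$ of disjoint subsets of $\mathrm{KA}(\mathcal{K})$; an atom is true in it if in $I_T$, false if in $I_F$; $(I_T,I_F)\le(I_T',I_F')$ iff $I_T\subseteq I_T'$ and $I_F\subseteq I_F'$. $\mathit{OpTrue}^{\mathcal{K}}_{\mathcal{I}}(Tr)=\{a\in\mathrm{KA}(\mathcal{K})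 : $ there is a rule $a\leftarrow a_1,\dots,a_n,\mathit{not}\,b_1,\dots,\mathit{not}\,b_r$ in $\mathcal{P}_g$ with each $a_i$ true in $\mathcal{I}$ or $a_i\in Tr$, and each $b_j$ false in $\mathcal{I}\}\cup\{a\in\mathrm{KA}(\mathcal{K}) : \mathrm{OB}_{\mathcal{K}}(I_T\cup Tr)\models a\}$. $\mathit{OpFalse}^{\mathcal{K}}_{\mathcal{I}}(Fa)=\{a\in\mathrm{KA}(\mathcal{K}) : \mathrm{OB}_{\mathcal{K}}(I_T)\models\neg a$, or for every rule $a\leftarrow a_1,\dots,a_n,\mathit{not}\,b_1,\dots,\mathit{not}\,b_r$ in $\mathcal{P}_g$ some $a_i$ is false in $\mathcal{I}$ or in $Fa$, or some $b_j$ is true in $\mathcal{I}\}\cap\{a\in\mathrm{KA}(\mathcal{K}) : \mathrm{OB}_{\mathcal{K}}(\mathrm{KA}(\mathcal{K})\setminus(I_F\cup Fa))\not\models a\}$. $\Phi_{\mathcal{K}}(\mathcal{I})=(\mathrm{lfp}(\mathit{OpTrue}^{\mathcal{K}}_{\mathcal{I}}),\ \mathrm{gfp}(\mathit{OpFalse}^{\mathcal{K}}_{\mathcal{I}}))$, least/greatest fixpoints w.r.t. set inclusion on subsets of $\mathrm{KA}(\mathcal{K})$. -}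

module Defs where

open import Level using (Level; 0ℓ) renaming (suc to lsuc)
open import Data.Nat using (ℕ; _≟_)
open import Data.Fin using (Fin)
open import Data.Vec using (Vec; []; _∷_)
open import Data.List using (List)
open import Data.List.Membership.Propositional using (_∈_)
open import Data.List.Relation.Unary.All using (All)
open import Data.List.Relation.Unary.Any using (Any)
open import Data.Product using (Σ; _×_; _,_; ∃-syntax)
open import Data.Sum using (_⊎_)
open import Data.Empty using (⊥)
open import Data.Unit using (⊤)
open import Relation.Nullary using (¬_; yes; no)
open import Relation.Binary.PropositionalEquality using (_≡_)

-- First-order signatures (constants = function symbols of arity 0)

record Signature : Set₁ where
  field
    Fun      : Set
    funArity : Fun → ℕ
    Pred     : Set
    predArity : Pred → ℕ

module _ {S : Signature} where
  open Signature S

  data Term : Set where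
    var : ℕ → Term
    fn  : (f : Fun) → Vec Term (funArity f) → Term

  data GTerm : Set where
    gfn : (f : Fun) → Vec GTerm (funArity f) → GTerm

  record Atom : Set where
    constructor atm
    field
      pred : Pred
      args : Vec Term (predArity pred)

  record GAtom : Set where
    constructor gatm
    field
      gpred : Pred
      gargs : Vec GTerm (predArity gpred)

  mutual
    emb : GTerm → Term
    emb (gfn f ts) = fn f (embs ts)

    embs : ∀ {n} → Vec GTerm n → Vec Term n
    embs [] = []
    embs (t ∷ ts) = emb t ∷ embs ts

  mutual
    inst : (ℕ → GTerm) → Term → GTerm
    inst σ (var x) = σ x
    inst σ (fn f ts) = gfn f (insts σ ts)

    insts : ∀ {n} → (ℕ → GTerm) → Vec Term n → Vec GTerm n
    insts σ [] = []
    insts σ (t ∷ ts) = inst σ t ∷ insts σ ts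

  instAtom : (ℕ → GTerm) → Atom → GAtom
  instAtom σ (atm p ts) = gatm p (insts σ ts)

  mutual
    VarInTerm : ℕ → Term → Set
    VarInTerm x (var y) = x ≡ y
    VarInTerm x (fn f ts) = VarInTerms x ts

    VarInTerms : ∀ {n} → ℕ → Vec Term n → Set
    VarInTerms x [] = ⊥
    VarInTerms x (t ∷ ts) = VarInTerm x t ⊎ VarInTerms x ts

  VarInAtom : ℕ → Atom → Set
  VarInAtom x (atm p ts) = VarInTerms x ts

  infixr 5 _⇒_
  data Formula : Set where
    atomF : Atom → Formula
    _≐_   : Term → Term → Formula
    ⊤F ⊥F : Formula
    ¬F_   : Formula → Formula
    _∧F_ _∨F_ _⇒_ : Formula → Formula → Formula
    ∀F ∃F : ℕ → Formula → Formula

  FreeIn : ℕ → Formula → Set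
  FreeIn x (atomF a) = VarInAtom x a
  FreeIn x (s ≐ t) = VarInTerm x s ⊎ VarInTerm x t
  FreeIn x ⊤F = ⊥
  FreeIn x ⊥F = ⊥
  FreeIn x (¬F φ) = FreeIn x φ
  FreeIn x (φ ∧F ψ) = FreeIn x φ ⊎ FreeIn x ψ
  FreeIn x (φ ∨F ψ) = FreeIn x φ ⊎ FreeIn x ψ
  FreeIn x (φ ⇒ ψ) = FreeIn x φ ⊎ FreeIn x ψ
  FreeIn x (∀F y φ) = ¬ (x ≡ y) × FreeIn x φ
  FreeIn x (∃F y φ) = ¬ (x ≡ y) × FreeIn x φ

  Sentence : Formula → Set
  Sentence φ = ∀ x → ¬ FreeIn x φ

  PredIn : Pred → Formula → Set
  PredIn p (atomF a) = Atom.pred a ≡ p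
  PredIn p (s ≐ t) = ⊥
  PredIn p ⊤F = ⊥
  PredIn p ⊥F = ⊥
  PredIn p (¬F φ) = PredIn p φ
  PredIn p (φ ∧F ψ) = PredIn p φ ⊎ PredIn p ψ
  PredIn p (φ ∨F ψ) = PredIn p φ ⊎ PredIn p ψ
  PredIn p (φ ⇒ ψ) = PredIn p φ ⊎ PredIn p ψ
  PredIn p (∀F y φ) = PredIn p φ
  PredIn p (∃F y φ) = PredIn p φ

  gatomF : GAtom → Formula
  gatomF (gatm p ts) = atomF (atm p (embs ts))

  record Structure : Set₁ where
    field
      Dom     : Set
      inhabit : Dom
      funI    : (f : Fun) → Vec Dom (funArity f) → Dom
      predI   : (p : Pred) → Vec Dom (predArity p) → Set

  module _ (M : Structure) where
    open Structure M

    update : (ℕ → Dom) → ℕ → Dom → ℕ → Dom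
    update ρ x d y with y ≟ x
    ... | yes _ = d
    ... | no _ = ρ y

    mutual
      evalT : (ℕ → Dom) → Term → Dom
      evalT ρ (var x) = ρ x
      evalT ρ (fn f ts) = funI f (evalTs ρ ts)

      evalTs : ∀ {n} → (ℕ → Dom) → Vec Term n → Vec Dom n
      evalTs ρ [] = []
      evalTs ρ (t ∷ ts) = evalT ρ t ∷ evalTs ρ ts

    Sat : (ℕ → Dom) → Formula → Set
    Sat ρ (atomF (atm p ts)) = predI p (evalTs ρ ts)
    Sat ρ (s ≐ t) = evalT ρ s ≡ evalT ρ t
    Sat ρ ⊤F = ⊤
    Sat ρ ⊥F = ⊥
    Sat ρ (¬F φ) = ¬ Sat ρ φ
    Sat ρ (φ ∧F ψ) = Sat ρ φ × Sat ρ ψ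
    Sat ρ (φ ∨F ψ) = Sat ρ φ ⊎ Sat ρ ψ
    Sat ρ (φ ⇒ ψ) = Sat ρ φ → Sat ρ ψ
    Sat ρ (∀F x φ) = (d : Dom) → Sat (update ρ x d) φ
    Sat ρ (∃F x φ) = Σ Dom λ d → Sat (update ρ x d) φ

  _⊨_ : ∀ {ℓ} → (Formula → Set ℓ) → Formula → Set (lsuc 0ℓ Level.⊔ ℓ)
  Γ ⊨ φ = (M : Structure) (ρ : ℕ → Structure.Dom M) →
          (∀ ψ → Γ ψ → Sat M ρ ψ) → Sat M ρ φ

-- A description logic, abstractly: a type of axioms together with its
-- standard translation into first-order sentences.

record DescriptionLogic (S : Signature) : Set₁ where
  field
    Axiom    : Set
    π        : Axiom → Formula {S}
    π-closed : ∀ ax → Sentence (π ax)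

module _ {S : Signature} where
  open Signature S

  record Rule : Set where
    constructor rule
    field
      head : Atom {S}
      pos  : List (Atom {S})
      neg  : List (Atom {S})

  record GRule : Set where
    constructor grule
    field
      ghead : GAtom {S}
      gpos  : List (GAtom {S})
      gneg  : List (GAtom {S})

  open Data.List using (map)

  instRule : (ℕ → GTerm {S}) → Rule → GRule
  instRule σ (rule h ps ns) =
    grule (instAtom σ h) (map (instAtom σ) ps) (map (instAtom σ) ns)

  VarInRule : ℕ → Rule → Set
  VarInRule x (rule h ps ns) =
    VarInAtom x h ⊎ Any (VarInAtom x) ps ⊎ Any (VarInAtom x) ns

  record HKB (L : DescriptionLogic S) : Set where
    constructor ⟨_,_⟩
    open DescriptionLogic L
    field
      𝒪 : List Axiom
      𝒫 : List Rule

  module _ {L : DescriptionLogic S} (K : HKB L) where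
    open DescriptionLogic L
    open HKB K

    πO : Formula {S} → Set
    πO φ = ∃[ ax ] (ax ∈ 𝒪 × φ ≡ π ax)

    DLAtom : Atom {S} → Set
    DLAtom a = ∃[ ax ] (ax ∈ 𝒪 × PredIn (Atom.pred a) (π ax))

    DLSafe : Set
    DLSafe = ∀ r → r ∈ 𝒫 → ∀ x → VarInRule x r →
             Any (λ b → ¬ DLAtom b × VarInAtom x b) (Rule.pos r)

    InPg : GRule → Set
    InPg g = ∃[ r ] ∃[ σ ] (r ∈ 𝒫 × g ≡ instRule σ r)

    KA : GAtom {S} → Set
    KA a = ∃[ g ] (InPg g × (a ≡ GRule.ghead g ⊎ a ∈ GRule.gpos g ⊎ a ∈ GRule.gneg g))

    OB⊨ : ∀ {ℓ} → (GAtom {S} → Set ℓ) → Formula {S} → Set (lsuc 0ℓ Level.⊔ ℓ)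
    OB⊨ X φ = (λ ψ → πO ψ ⊎ ∃[ b ] (X b × ψ ≡ gatomF b)) ⊨ φ

    SetA₁ : Set₂
    SetA₁ = GAtom {S} → Set₁

    SetA₂ : Set₃
    SetA₂ = GAtom {S} → Set₂

    record Interp : Set₂ where
      constructor interp
      field
        IT : SetA₁
        IF : SetA₁
        IT⊆KA : ∀ a → IT a → KA a
        IF⊆KA : ∀ a → IF a → KA a
        disjoint : ∀ a → IT a → IF a → ⊥

    _≤I_ : Interp → Interp → Set₁
    I ≤I J = (∀ a → Interp.IT I a → Interp.IT J a) ×
             (∀ a → Interp.IF I a → Interp.IF J a)

    module _ (I : Interp) where
      open Interp I

      OpTrue : SetA₁ → SetA₁
      OpTrue Tr a = KA a ×
        ( (∃[ g ] (InPg g × GRule.ghead g ≡ a ×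
                   All (λ ai → IT ai ⊎ Tr ai) (GRule.gpos g) ×
                   All IF (GRule.gneg g)))
        ⊎ OB⊨ (λ b → IT b ⊎ Tr b) (gatomF a))

      OpFalse : SetA₁ → SetA₁
      OpFalse Fa a = KA a ×
        ( OB⊨ IT (¬F gatomF a)
        ⊎ (∀ g → InPg g → GRule.ghead g ≡ a →
             Any (λ ai → IF ai ⊎ Fa ai) (GRule.gpos g) ⊎
             Any IT (GRule.gneg g)))
        × ¬ OB⊨ (λ b → KA b × ¬ (IF b ⊎ Fa b)) (gatomF a)

      -- least fixpoint: intersection of all pre-fixpoints ⊆ KA(K)
      lfpOpTrue : SetA₂
      lfpOpTrue a = (Y : SetA₁) → (∀ b → Y b → KA b) →
                    (∀ b → OpTrue Y b → Y b) → Y a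

      -- greatest fixpoint: union of all post-fixpoints ⊆ KA(K)
      gfpOpFalse : SetA₂
      gfpOpFalse a = Σ SetA₁ λ Y → (∀ b → Y b → KA b) ×
                     (∀ b → Y b → OpFalse Y b) × Y a

    Φ : Interp → SetA₂ × SetA₂
    Φ I = lfpOpTrue I , gfpOpFalse I

    _≤Φ_ : SetA₂ × SetA₂ → SetA₂ × SetA₂ → Set₂
    (T , F) ≤Φ (T' , F') = (∀ a → T a → T' a) × (∀ a → F a → F' a)

{-# OPTIONS --safe #-}
module Submission where

-- Both OpTrue and OpFalse only ever consult the interpretation positively: the
-- true atoms of I feed positive premises and the knowledge base OB(I_T ∪ Tr),
-- the false atoms feed failing premises and shrink the set KA \ (I_F ∪ Fa) whose
-- non-entailment is required. So enlarging I enlarges both operators pointwise,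
-- and the least and greatest fixpoints of pointwise larger operators are larger.

open import Level using (Level; _⊔_) renaming (suc to lsuc)
open import Data.Product using (_×_; _,_; Σ; proj₁; proj₂)
open import Data.Sum using (_⊎_; inj₁; inj₂; map; map₁)
open import Data.List.Relation.Unary.All as All using ()
open import Data.List.Relation.Unary.Any as Any using ()
open import Relation.Unary using (Pred; _⊆_; _∪_; _∩_; ∁)
open import Relation.Binary.PropositionalEquality using (_≡_)
open import Defs

-- lfpOpTrue I and gfpOpFalse I are definitionally Lfp (KA K) (OpTrue K I) and
-- Gfp (KA K) (OpFalse K I).
module _ {a ℓ} {A : Set a} (P : Pred A ℓ) {ℓ′ : Level} where

  Lfp : (Pred A ℓ′ → Pred A ℓ′) → Pred A (a ⊔ ℓ ⊔ lsuc ℓ′)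
  Lfp F x = (Y : Pred A ℓ′) → (∀ b → Y b → P b) → (∀ b → F Y b → Y b) → Y x

  Gfp : (Pred A ℓ′ → Pred A ℓ′) → Pred A (a ⊔ ℓ ⊔ lsuc ℓ′)
  Gfp F x = Σ (Pred A ℓ′) λ Y → (∀ b → Y b → P b) × (∀ b → Y b → F Y b) × Y x

  Lfp-mono : {F G : Pred A ℓ′ → Pred A ℓ′} → (∀ Y → F Y ⊆ G Y) → Lfp F ⊆ Lfp G
  Lfp-mono F⊆G lfpF Y Y⊆P G-pre = lfpF Y Y⊆P (λ b FYb → G-pre b (F⊆G Y FYb))

  Gfp-mono : {F G : Pred A ℓ′ → Pred A ℓ′} → (∀ Y → F Y ⊆ G Y) → Gfp F ⊆ Gfp G
  Gfp-mono F⊆G (Y , Y⊆P , F-post , Yx) = Y , Y⊆P , (λ b Yb → F⊆G Y (F-post b Yb)) , Yx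

module _ {S : Signature} {L : DescriptionLogic S} (K : HKB L) where

  OB⊨-mono : ∀ {ℓ ℓ′} {X : Pred (GAtom {S}) ℓ} {X′ : Pred (GAtom {S}) ℓ′} →
             X ⊆ X′ → ∀ φ → OB⊨ K X φ → OB⊨ K X′ φ
  OB⊨-mono X⊆X′ φ X⊨φ M ρ sat = X⊨φ M ρ λ where
    ψ (inj₁ ψ∈πO)          → sat ψ (inj₁ ψ∈πO)
    ψ (inj₂ (b , Xb , eq)) → sat ψ (inj₂ (b , X⊆X′ Xb , eq))

  module _ {I I′ : Interp K} (I≤I′ : _≤I_ K I I′) where
    open Interp I
    open Interp I′ renaming (IT to IT′; IF to IF′)

    private
      IT⊆IT′ : IT ⊆ IT′
      IT⊆IT′ = proj₁ I≤I′ _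

      IF⊆IF′ : IF ⊆ IF′
      IF⊆IF′ = proj₂ I≤I′ _

    OpTrue-mono : ∀ Tr → OpTrue K I Tr ⊆ OpTrue K I′ Tr
    OpTrue-mono Tr (ka , inj₁ (g , g∈Pg , head≡ , pos , neg)) =
      ka , inj₁ (g , g∈Pg , head≡ , All.map (map₁ IT⊆IT′) pos , All.map IF⊆IF′ neg)
    OpTrue-mono Tr (ka , inj₂ entailed) =
      ka , inj₂ (OB⊨-mono (map₁ IT⊆IT′) (gatomF _) entailed)

    OpFalse-mono : ∀ Fa → OpFalse K I Fa ⊆ OpFalse K I′ Fa
    OpFalse-mono Fa (ka , refuted , not-entailed) =
      ka , map (OB⊨-mono IT⊆IT′ (¬F gatomF _)) blocked-mono refuted ,
      λ entailed → not-entailed (OB⊨-mono unfalsified-anti (gatomF _) entailed)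
      where
      Blocked : Pred (GAtom {S}) _ → Pred (GAtom {S}) _ → GRule {S} → Set₁
      Blocked F T g = Any.Any (F ∪ Fa) (GRule.gpos g) ⊎ Any.Any T (GRule.gneg g)

      blocked-mono : ∀ {a} → (∀ g → InPg K g → GRule.ghead g ≡ a → Blocked IF IT g) →
                     ∀ g → InPg K g → GRule.ghead g ≡ a → Blocked IF′ IT′ g
      blocked-mono blocked g g∈Pg head≡ =
        map (Any.map (map₁ IF⊆IF′)) (Any.map IT⊆IT′) (blocked g g∈Pg head≡)

      unfalsified-anti : KA K ∩ ∁ (IF′ ∪ Fa) ⊆ KA K ∩ ∁ (IF ∪ Fa)
      unfalsified-anti (kb , not-falsified′) = kb , λ falsified → not-falsified′ (map₁ IF⊆IF′ falsified)

proposition3 : (S : Signature) (L : DescriptionLogic S) (K : HKB L) →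
               DLSafe K → (I I' : Interp K) → _≤I_ K I I' →
               _≤Φ_ K (Φ K I) (Φ K I')
proposition3 S L K _ I I' I≤I' =
  (λ _ → Lfp-mono (KA K) (OpTrue-mono K {I} {I'} I≤I')) ,
  (λ _ → Gfp-mono (KA K) (OpFalse-mono K {I} {I'} I≤I'))
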